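{- Let $\mathcal{P}=(Q,\delta)$ be an MFDO protocol, and let $C\to^* C'$ be an execution of $\mathcal{P}$. Then there exists a sequence $\xi$ of transitions such that $C\xrightarrow{\xi}C'$ and $|\xi|_a\le |Q|^4$.
   Context: A message-free delayed observation (MFDO) protocol is a pair $(Q,\delta)$ with $Q$ a finite set of states and $\delta$ a set of transitions written $q\xrightarrow{o}q'$ with $q,o,q'\in Q$. Configurations are multisets over $Q$. Finite executions are defined inductively: every configuration $C_0$ is a finite execution; a finite execution $C_0,\dots,C_i$ enables $q\xrightarrow{o}q'$ if $C_i(q)\ge1$ and $C_j(o)\ge 1$ for some $j\le i$, and in that case $C_0,\dots,C_i,C_{i+1}$ with $C_{i+1}=C_i-\{\!\{q\}\!\}+\{\!\{q'\}\!\}$ is a finite execution. $C\to^*C'$ means some finite execution starts at $C$ and ends at $C'$; $C\xrightarrow{\xi}C'$ for $\xi=t_1\cdots t_n$ means there is a finite execution $C=C_0,\dots,C_n=C'$ in which each $C_{i+1}$ is obtained from $C_0,\dots,C_i$ by the enabled transition $t_{i+1}$. For a nonempty sequence $\xi$, writing uniquely $\xi=t_1^{k_1}t_2^{k_2}\cdots t_m^{k_m}$ with $k_i\ge1$ and $t_i\ne t_{i+1}$, the aggregated length of $\xi$ is $|\xi|_a=m$. -}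

module Defs where

open import Data.Nat using (ℕ; zero; suc; pred; _≤_)
open import Data.Fin using (Fin)
open import Data.Fin.Properties using () renaming (_≟_ to _≟ᶠ_)
open import Data.Vec using (Vec; lookup; _[_]%=_)
open import Data.List using (List; []; _∷_; _∷ʳ_)
open import Data.List.Membership.Propositional using (_∈_)
open import Data.List.Relation.Unary.Any using (Any)
open import Data.Product using (_×_; _,_; Σ; ∃)
open import Data.Product.Properties using (≡-dec)
open import Relation.Binary.PropositionalEquality using (_≡_)
open import Relation.Nullary using (yes; no)
open import Relation.Binary.Definitions using (DecidableEquality)

-- States of a protocol with |Q| = n are Fin n.
-- A transition q --o--> q' is the triple (q , o , q').
Transition : ℕ → Set
Transition n = Fin n × Fin n × Fin n

_≟ₜ_ : ∀ {n} → DecidableEquality (Transition n)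
_≟ₜ_ = ≡-dec _≟ᶠ_ (≡-dec _≟ᶠ_ _≟ᶠ_)

record MFDO (n : ℕ) : Set where
  field
    δ : List (Transition n)

-- Configurations: multisets over Fin n, as vectors of multiplicities.
Config : ℕ → Set
Config n = Vec ℕ n

move : ∀ {n} → Config n → Fin n → Fin n → Config n
move C q q' = (C [ q ]%= pred) [ q' ]%= suc

-- Run P C₀ C hist ξ : there is a finite execution C₀, …, Cᵢ = C using the
-- transitions ξ (in order), where hist lists the earlier configurations
-- Cᵢ₋₁, …, C₀ (most recent first).  A step from C via q --o--> q' needs
-- C(q) ≥ 1 and some Cⱼ (j ≤ i), i.e. some element of C ∷ hist, with Cⱼ(o) ≥ 1.
data Run {n : ℕ} (P : MFDO n) (C₀ : Config n)
     : Config n → List (Config n) → List (Transition n) → Set where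
  start : Run P C₀ C₀ [] []
  step  : ∀ {C hist ξ q o q'} →
          Run P C₀ C hist ξ →
          (q , o , q') ∈ MFDO.δ P →
          1 ≤ lookup C q →
          Any (λ D → 1 ≤ lookup D o) (C ∷ hist) →
          Run P C₀ (move C q q') (C ∷ hist) (ξ ∷ʳ (q , o , q'))

Reach : ∀ {n} → MFDO n → Config n → Config n → Set
Reach P C C' = ∃ λ hist → ∃ λ ξ → Run P C C' hist ξ

ReachVia : ∀ {n} → MFDO n → Config n → List (Transition n) → Config n → Set
ReachVia P C ξ C' = ∃ λ hist → Run P C C' hist ξ

-- aggregated length: number of maximal blocks of equal consecutive
-- transitions (0 for the empty sequence).
-- blocksAfter t ts : number of blocks in ts not merged with preceding t.
blocksAfter : ∀ {n} → Transition n → List (Transition n) → ℕ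
blocksAfter t [] = 0
blocksAfter t (t' ∷ ts) with t ≟ₜ t'
... | yes _ = blocksAfter t' ts
... | no  _ = suc (blocksAfter t' ts)

aggLen : ∀ {n} → List (Transition n) → ℕ
aggLen [] = 0
aggLen (t ∷ ts) = suc (blocksAfter t ts)

-- Cut the execution into phases: a phase ends just before a transition that
-- populates a state never populated before.  The set of seen states grows at
-- each cut, so there are at most |Q| phases.  Inside a phase the observable
-- states are fixed, so a transition q →ᵒ q' with o seen fires whenever q is
-- populated; the phase is then described by its token flow f (tokens moved
-- along each edge), which satisfies conservation D + in f = C + out f.  Any
-- such flow is realised with at most one block per edge of its support, hence
-- at most |Q|² blocks: fire an edge u → v with f(u,v) ≤ D(u) in full, or, if
-- no edge is ready, find a simple cycle in the support and cancel it.  Each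
-- phase costs at most |Q|² + 1 blocks, and (|Q|²+1)(|Q|-1) + |Q|² ≤ |Q|⁴.

module Submission where

open import Defs
open import Data.Nat
  using (ℕ; zero; suc; pred; _+_; _*_; _∸_; _^_; _≤_; _<_; _≤?_; z≤n; s≤s; s≤s⁻¹)
open import Data.Nat.Properties
open import Data.Nat.Induction using (<-wellFounded)
open import Data.Nat.Tactic.RingSolver using (solve-∀)
open import Data.Fin using (Fin; zero; suc) renaming (_≟_ to _≟ᶠ_)
open import Data.Fin.Properties using (any?; injective⇒≤)
open import Data.Vec using (Vec; lookup; _[_]%=_; tabulate)
open import Data.Vec.Properties
  using (lookup∘updateAt; lookup∘updateAt′; tabulate∘lookup; tabulate-cong)
open import Data.List as List using (List; []; _∷_; _++_; _∷ʳ_; replicate; length)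
open import Data.List.Properties using (++-assoc; ++-identityʳ)
open import Data.List.Membership.Propositional using (_∈_)
open import Data.List.Membership.Propositional.Properties using (∈-lookup)
open import Data.List.Relation.Unary.Any as Any using (Any; here; there)
open import Data.Product using (∃; _×_; _,_)
open import Data.Sum using (_⊎_; inj₁; inj₂)
open import Data.Empty using (⊥-elim)
open import Function using (_∘_)
open import Induction.WellFounded using (Acc; acc)
open import Relation.Binary.PropositionalEquality
open import Relation.Nullary using (¬_; Dec; yes; no)
open import Relation.Nullary.Decidable using (_×-dec_)
open import Algebra.Properties.Semiring.Sum +-*-semiring
  using (sum; sum-cong-≗; ∑-distrib-+; *-distribˡ-sum; *-distribʳ-sum; sum-replicate-zero)

private
  variable
    n : ℕ

∑-term : (g : Fin n → ℕ) (i : Fin n) → g i ≤ sum g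
∑-term g zero    = m≤m+n _ _
∑-term g (suc i) = ≤-trans (∑-term (g ∘ suc) i) (m≤n+m _ (g zero))

∑-witness : (g : Fin n → ℕ) → 1 ≤ sum g → ∃ λ i → 1 ≤ g i
∑-witness {suc n} g p with g zero in eq
... | suc _ = zero , subst (1 ≤_) (sym eq) (s≤s z≤n)
... | zero  with ∑-witness (g ∘ suc) p
...   | i , q = suc i , q

∑-mono : {g h : Fin n → ℕ} → (∀ i → g i ≤ h i) → sum g ≤ sum h
∑-mono {zero}  le = z≤n
∑-mono {suc n} le = +-mono-≤ (le zero) (∑-mono (le ∘ suc))

∑-bound : {g : Fin n → ℕ} (k : ℕ) → (∀ i → g i ≤ k) → sum g ≤ n * k
∑-bound {zero}  k le = z≤n
∑-bound {suc n} k le = +-mono-≤ (le zero) (∑-bound k (le ∘ suc))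

∑-≤1 : {g : Fin n → ℕ} → (∀ i → g i ≤ 1) → sum g ≤ n
∑-≤1 {n} le = ≤-trans (∑-bound 1 le) (≤-reflexive (*-identityʳ n))

∑-mono-< : {g h : Fin n → ℕ} → (∀ i → g i ≤ h i) → (j : Fin n) → g j < h j → sum g < sum h
∑-mono-< le zero    lt = +-mono-<-≤ lt (∑-mono (le ∘ suc))
∑-mono-< le (suc j) lt = +-mono-≤-< (le zero) (∑-mono-< (le ∘ suc) j lt)

∑-zero : {g : Fin n → ℕ} → (∀ i → g i ≡ 0) → sum g ≡ 0
∑-zero {n} z = trans (sum-cong-≗ z) (sum-replicate-zero n)

χ : Fin n → Fin n → ℕ
χ zero    zero    = 1
χ zero    (suc _) = 0
χ (suc _) zero    = 0
χ (suc x) (suc a) = χ x a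

χ-refl : (a : Fin n) → χ a a ≡ 1
χ-refl zero    = refl
χ-refl (suc a) = χ-refl a

χ-≢ : {x a : Fin n} → x ≢ a → χ x a ≡ 0
χ-≢ {x = zero}  {zero}  ne = ⊥-elim (ne refl)
χ-≢ {x = zero}  {suc a} ne = refl
χ-≢ {x = suc x} {zero}  ne = refl
χ-≢ {x = suc x} {suc a} ne = χ-≢ (ne ∘ cong suc)

∑-χ : (a : Fin n) → sum (λ x → χ x a) ≡ 1
∑-χ {suc n} zero    = cong suc (sum-replicate-zero n)
∑-χ {suc n} (suc a) = ∑-χ a

-- A flow assigns to each edge u → v the number of tokens moved along it.
Flow : ℕ → Set
Flow n = Fin n → Fin n → ℕ

inflow outflow : Flow n → Fin n → ℕ
inflow  f x = sum (λ w → f w x)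
outflow f x = sum (λ y → f x y)

unit : Fin n → Fin n → Flow n
unit u v a b = χ a u * χ b v

OneMore : Flow n → Flow n → Fin n → Fin n → Set
OneMore f g u v = ∀ a b → f a b ≡ g a b + unit u v a b

inflow-oneMore : ∀ {f g : Flow n} {u v} → OneMore f g u v → ∀ x → inflow f x ≡ inflow g x + χ x v
inflow-oneMore {f = f} {g} {u} {v} e x = begin
  inflow f x                              ≡⟨ sum-cong-≗ (λ a → e a x) ⟩
  sum (λ a → g a x + χ a u * χ x v)       ≡⟨ ∑-distrib-+ (λ a → g a x) _ ⟩
  inflow g x + sum (λ a → χ a u * χ x v)
    ≡⟨ cong (inflow g x +_) (*-distribʳ-sum (χ x v) (λ a → χ a u)) ⟨
  inflow g x + sum (λ a → χ a u) * χ x v  ≡⟨ cong (λ s → inflow g x + s * χ x v) (∑-χ u) ⟩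
  inflow g x + 1 * χ x v                  ≡⟨ cong (inflow g x +_) (*-identityˡ (χ x v)) ⟩
  inflow g x + χ x v                      ∎
  where open ≡-Reasoning

outflow-oneMore : ∀ {f g : Flow n} {u v} → OneMore f g u v → ∀ x → outflow f x ≡ outflow g x + χ x u
outflow-oneMore {f = f} {g} {u} {v} e x = begin
  outflow f x                              ≡⟨ sum-cong-≗ (e x) ⟩
  sum (λ b → g x b + χ x u * χ b v)        ≡⟨ ∑-distrib-+ (g x) _ ⟩
  outflow g x + sum (λ b → χ x u * χ b v)
    ≡⟨ cong (outflow g x +_) (*-distribˡ-sum (χ x u) (λ b → χ b v)) ⟨
  outflow g x + χ x u * sum (λ b → χ b v)  ≡⟨ cong (λ s → outflow g x + χ x u * s) (∑-χ v) ⟩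
  outflow g x + χ x u * 1                  ≡⟨ cong (outflow g x +_) (*-identityʳ (χ x u)) ⟩
  outflow g x + χ x u                      ∎
  where open ≡-Reasoning

Balanced : (Fin n → ℕ) → Flow n → (Fin n → ℕ) → Set
Balanced d f c = ∀ x → d x + inflow f x ≡ c x + outflow f x

private
  swapʳ : ∀ x y z → x + y + z ≡ x + z + y
  swapʳ = solve-∀

  regroup : ∀ x y z → x + y + z ≡ x + (z + y)
  regroup = solve-∀

  -- The arithmetic behind shifting a token from the flow into the start profile:
  -- d' + a = d + b, so d + (i + b) = c + (o + a) iff d' + i = c + o.
  transfer : ∀ {d d' i o c a b} → d' + a ≡ d + b → d + (i + b) ≡ c + (o + a) → d' + i ≡ c + o
  transfer {d} {d'} {i} {o} {c} {a} {b} moved bal = +-cancelʳ-≡ a _ _ (begin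
    d' + i + a   ≡⟨ swapʳ d' i a ⟩
    d' + a + i   ≡⟨ cong (_+ i) moved ⟩
    d + b + i    ≡⟨ regroup d b i ⟩
    d + (i + b)  ≡⟨ bal ⟩
    c + (o + a)  ≡⟨ sym (+-assoc c o a) ⟩
    c + o + a    ∎)
    where open ≡-Reasoning

  untransfer : ∀ {d d' i o c a b} → d' + a ≡ d + b → d' + i ≡ c + o → d + (i + b) ≡ c + (o + a)
  untransfer {d} {d'} {i} {o} {c} {a} {b} moved bal = begin
    d + (i + b)  ≡⟨ sym (regroup d b i) ⟩
    d + b + i    ≡⟨ cong (_+ i) (sym moved) ⟩
    d' + a + i   ≡⟨ swapʳ d' a i ⟩
    d' + i + a   ≡⟨ cong (_+ a) bal ⟩
    c + o + a    ≡⟨ +-assoc c o a ⟩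
    c + (o + a)  ∎
    where open ≡-Reasoning

shift : ∀ {d d' c : Fin n → ℕ} {f g u v} → OneMore f g u v →
        (∀ x → d' x + χ x u ≡ d x + χ x v) → Balanced d f c → Balanced d' g c
shift {d = d} {d'} {c} {g = g} {u} {v} e moved bal x =
  transfer {d x} {d' x} {inflow g x} {outflow g x} {c x} {χ x u} {χ x v} (moved x)
  (trans (cong (d x +_) (sym (inflow-oneMore e x)))
  (trans (bal x) (cong (c x +_) (outflow-oneMore e x))))

unshift : ∀ {d d' c : Fin n → ℕ} {f g u v} → OneMore f g u v →
          (∀ x → d' x + χ x u ≡ d x + χ x v) → Balanced d' g c → Balanced d f c
unshift {d = d} {d'} {c} {g = g} {u} {v} e moved bal x =
  trans (cong (d x +_) (inflow-oneMore e x))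
  (trans (untransfer {d x} {d' x} {inflow g x} {outflow g x} {c x} {χ x u} {χ x v} (moved x) (bal x))
  (cong (c x +_) (sym (outflow-oneMore e x))))

_+[_] : (Fin n → ℕ) → Fin n → (Fin n → ℕ)
(d +[ a ]) x = d x + χ x a

addToken : ∀ {d c : Fin n → ℕ} {f} a → Balanced d f c → Balanced (d +[ a ]) f (c +[ a ])
addToken {d = d} {c} {f} a bal x = begin
  d x + χ x a + inflow f x   ≡⟨ swapʳ (d x) _ _ ⟩
  d x + inflow f x + χ x a   ≡⟨ cong (_+ χ x a) (bal x) ⟩
  c x + outflow f x + χ x a  ≡⟨ swapʳ (c x) _ _ ⟩
  c x + χ x a + outflow f x  ∎
  where open ≡-Reasoning

removeToken : ∀ {d c : Fin n → ℕ} {f} a → Balanced (d +[ a ]) f (c +[ a ]) → Balanced d f c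
removeToken {d = d} {c} {f} a bal x = +-cancelʳ-≡ (χ x a) _ _ (begin
  d x + inflow f x + χ x a   ≡⟨ swapʳ (d x) _ _ ⟩
  d x + χ x a + inflow f x   ≡⟨ bal x ⟩
  c x + χ x a + outflow f x  ≡⟨ swapʳ (c x) _ _ ⟩
  c x + outflow f x + χ x a  ∎)
  where open ≡-Reasoning

shiftToken : ∀ {d c : Fin n → ℕ} {f g a b} → OneMore f g a b →
             Balanced (d +[ a ]) f c → Balanced (d +[ b ]) g c
shiftToken {d = d} {a = a} {b} e = shift e (λ x → swapʳ (d x) (χ x b) (χ x a))

move-balance : (C : Config n) (q q' x : Fin n) → 1 ≤ lookup C q →
               lookup (move C q q') x + χ x q ≡ lookup C x + χ x q'
move-balance C q q' x pos with x ≟ᶠ q' | x ≟ᶠ q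
... | yes refl | yes refl
  rewrite lookup∘updateAt x {suc} (C [ x ]%= pred) | lookup∘updateAt x {pred} C | χ-refl x
  with lookup C x | pos
...   | suc c | _ = refl
move-balance C q q' x pos | yes refl | no x≢q
  rewrite lookup∘updateAt x {suc} (C [ q ]%= pred) | lookup∘updateAt′ x q {pred} x≢q C
        | χ-refl x | χ-≢ x≢q = trans (cong suc (+-identityʳ _)) (+-comm 1 _)
move-balance C q q' x pos | no x≢q' | yes refl
  rewrite lookup∘updateAt′ x q' {suc} x≢q' (C [ x ]%= pred) | lookup∘updateAt x {pred} C
        | χ-refl x | χ-≢ x≢q'
  with lookup C x | pos
...   | suc c | _ = trans (+-comm c 1) (sym (+-identityʳ _))
move-balance C q q' x pos | no x≢q' | no x≢q
  rewrite lookup∘updateAt′ x q' {suc} x≢q' (C [ q ]%= pred) | lookup∘updateAt′ x q {pred} x≢q C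
        | χ-≢ x≢q' | χ-≢ x≢q = refl

move-target : (C : Config n) (q q' : Fin n) → 1 ≤ lookup (move C q q') q'
move-target C q q' rewrite lookup∘updateAt q' {suc} (C [ q ]%= pred) = s≤s z≤n

move-support : (C : Config n) (q q' x : Fin n) → 1 ≤ lookup C q →
               1 ≤ lookup (move C q q') x → x ≡ q' ⊎ 1 ≤ lookup C x
move-support C q q' x pos p with x ≟ᶠ q'
... | yes x≡q' = inj₁ x≡q'
... | no  x≢q' = inj₂ (≤-trans p (≤-trans (m≤m+n _ (χ x q)) (≤-reflexive (begin
  lookup (move C q q') x + χ x q  ≡⟨ move-balance C q q' x pos ⟩
  lookup C x + χ x q'             ≡⟨ cong (lookup C x +_) (χ-≢ x≢q') ⟩
  lookup C x + 0                  ≡⟨ +-identityʳ _ ⟩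
  lookup C x                      ∎))))
  where open ≡-Reasoning

move-source : (C : Config n) (q q' : Fin n) → 1 ≤ lookup C q →
              lookup C q ≤ suc (lookup (move C q q') q)
move-source C q q' pos = begin
  lookup C q                            ≤⟨ m≤m+n _ (χ q q') ⟩
  lookup C q + χ q q'                   ≡⟨ sym (move-balance C q q' q pos) ⟩
  lookup (move C q q') q + χ q q        ≡⟨ cong (lookup (move C q q') q +_) (χ-refl q) ⟩
  lookup (move C q q') q + 1            ≡⟨ +-comm _ 1 ⟩
  suc (lookup (move C q q') q)          ∎
  where open ≤-Reasoning

fire : ∀ {D : Config n} {c : Fin n → ℕ} {f g u v} → OneMore f g u v → 1 ≤ lookup D u →
       Balanced (lookup D) f c → Balanced (lookup (move D u v)) g c
fire {D = D} {u = u} {v} e pos = shift e (λ x → move-balance D u v x pos)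

unfire : ∀ {D : Config n} {c : Fin n → ℕ} {f g u v} → OneMore f g u v → 1 ≤ lookup D u →
         Balanced (lookup (move D u v)) g c → Balanced (lookup D) f c
unfire {D = D} {u = u} {v} e pos = unshift e (λ x → move-balance D u v x pos)

balanced-empty : ∀ {D C : Config n} {f : Flow n} → (∀ a b → f a b ≡ 0) →
                 Balanced (lookup D) f (lookup C) → D ≡ C
balanced-empty {D = D} {C} {f} empty bal = begin
  D                    ≡⟨ tabulate∘lookup D ⟨
  tabulate (lookup D)  ≡⟨ tabulate-cong same ⟩
  tabulate (lookup C)  ≡⟨ tabulate∘lookup C ⟩
  C                    ∎
  where
  open ≡-Reasoning
  same : ∀ x → lookup D x ≡ lookup C x
  same x = +-cancelʳ-≡ 0 _ _ (begin
    lookup D x + 0            ≡⟨ cong (lookup D x +_) (∑-zero (λ w → empty w x)) ⟨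
    lookup D x + inflow f x   ≡⟨ bal x ⟩
    lookup C x + outflow f x  ≡⟨ cong (lookup C x +_) (∑-zero (empty x)) ⟩
    lookup C x + 0            ∎)

blocksAfter-≤ : (t : Transition n) (ts : List (Transition n)) → blocksAfter t ts ≤ aggLen ts
blocksAfter-≤ t []        = z≤n
blocksAfter-≤ t (t' ∷ ts) with t ≟ₜ t'
... | yes _ = n≤1+n _
... | no  _ = ≤-refl

blocksAfter-++ : (t : Transition n) (xs ys : List (Transition n)) →
                 blocksAfter t (xs ++ ys) ≤ blocksAfter t xs + aggLen ys
blocksAfter-++ t []       ys = blocksAfter-≤ t ys
blocksAfter-++ t (x ∷ xs) ys with t ≟ₜ x
... | yes _ = blocksAfter-++ x xs ys
... | no  _ = s≤s (blocksAfter-++ x xs ys)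

aggLen-++ : (xs ys : List (Transition n)) → aggLen (xs ++ ys) ≤ aggLen xs + aggLen ys
aggLen-++ []       ys = ≤-refl
aggLen-++ (x ∷ xs) ys = s≤s (blocksAfter-++ x xs ys)

blocksAfter-same : (t : Transition n) (ts : List (Transition n)) →
                   blocksAfter t (t ∷ ts) ≡ blocksAfter t ts
blocksAfter-same t ts with t ≟ₜ t
... | yes _   = refl
... | no  t≢t = ⊥-elim (t≢t refl)

aggLen-replicate : ∀ k (t : Transition n) → 1 ≤ k → aggLen (replicate k t) ≡ 1
aggLen-replicate (suc zero)    t _ = refl
aggLen-replicate (suc (suc k)) t _ =
  trans (cong suc (blocksAfter-same t (replicate k t))) (aggLen-replicate (suc k) t (s≤s z≤n))

-- RunWithin P S D ρ C: ρ leads from D to C and every transition of ρ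
-- observes a state in S, so a step only needs its source to be populated.
data RunWithin (P : MFDO n) (S : Fin n → Set) : Config n → List (Transition n) → Config n → Set where
  done : ∀ {C} → RunWithin P S C [] C
  next : ∀ {C C' ρ q o q'} → (q , o , q') ∈ MFDO.δ P → S o → 1 ≤ lookup C q →
         RunWithin P S (move C q q') ρ C' → RunWithin P S C ((q , o , q') ∷ ρ) C'

runWithin-++ : ∀ {P : MFDO n} {S D E F xs ys} →
               RunWithin P S D xs E → RunWithin P S E ys F → RunWithin P S D (xs ++ ys) F
runWithin-++ done                  r = r
runWithin-++ (next t∈δ o∈S pos r₁) r = next t∈δ o∈S pos (runWithin-++ r₁ r)

_≤ᶠ_ : Flow n → Flow n → Set
g ≤ᶠ f = ∀ a b → g a b ≤ f a b

Supported : MFDO n → (Fin n → Set) → Flow n → Set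
Supported P S f = ∀ a b → 1 ≤ f a b → ∃ λ o → (a , o , b) ∈ MFDO.δ P × S o

supported-≤ᶠ : ∀ {P : MFDO n} {S} {f g : Flow n} → g ≤ᶠ f → Supported P S f → Supported P S g
supported-≤ᶠ g≤f sup a b p = sup a b (≤-trans p (g≤f a b))

addUnit : Flow n → Fin n → Fin n → Flow n
addUnit g u v a b = g a b + unit u v a b

supported-addUnit : ∀ {P : MFDO n} {S} {g : Flow n} {u o v} → Supported P S g →
                    (u , o , v) ∈ MFDO.δ P → S o → Supported P S (addUnit g u v)
supported-addUnit {g = g} {u} {o} {v} sup t∈δ o∈S a b p with a ≟ᶠ u | b ≟ᶠ v
... | yes refl | yes refl = o , t∈δ , o∈S
... | yes refl | no b≢v
  rewrite χ-≢ b≢v | *-zeroʳ (χ a a) | +-identityʳ (g a b) = sup a b p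
... | no a≢u   | _ rewrite χ-≢ a≢u | +-identityʳ (g a b) = sup a b p

runFlow : ∀ {P : MFDO n} {S D ρ C} → RunWithin P S D ρ C →
          ∃ λ f → Balanced (lookup D) f (lookup C) × Supported P S f
runFlow done = (λ _ _ → 0) , (λ x → refl) , (λ a b ())
runFlow {D = D} (next {q = q} {o} {q'} t∈δ o∈S pos r) with runFlow r
... | g , bal , sup =
  addUnit g q q' , unfire {D = D} (λ _ _ → refl) pos bal , supported-addUnit sup t∈δ o∈S

total : Flow n → ℕ
total f = sum (λ a → sum (λ b → f a b))

nonzero : ℕ → ℕ
nonzero zero    = 0
nonzero (suc _) = 1

support : Flow n → ℕ
support f = sum (λ a → sum (λ b → nonzero (f a b)))

total-< : ∀ {f g : Flow n} → g ≤ᶠ f → ∀ u v → g u v < f u v → total g < total f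
total-< g≤f u v lt = ∑-mono-< (λ a → ∑-mono (g≤f a)) u (∑-mono-< (g≤f u) v lt)

nonzero-mono : ∀ {x y} → x ≤ y → nonzero x ≤ nonzero y
nonzero-mono {zero}          _ = z≤n
nonzero-mono {suc x} {suc y} _ = ≤-refl

support-mono : ∀ {f g : Flow n} → g ≤ᶠ f → support g ≤ support f
support-mono g≤f = ∑-mono (λ a → ∑-mono (λ b → nonzero-mono (g≤f a b)))

support-< : ∀ {f g : Flow n} → g ≤ᶠ f → ∀ u v → g u v ≡ 0 → 1 ≤ f u v → support g < support f
support-< {f = f} {g} g≤f u v g≡0 pos =
  ∑-mono-< (λ a → ∑-mono (λ b → nonzero-mono (g≤f a b))) u
    (∑-mono-< (λ b → nonzero-mono (g≤f u b)) v (emptied (g u v) (f u v) g≡0 pos))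
  where
  emptied : ∀ x y → x ≡ 0 → 1 ≤ y → nonzero x < nonzero y
  emptied .0 (suc y) refl _ = s≤s z≤n

support-bound : (f : Flow n) → support f ≤ n * n
support-bound {n} f = ∑-bound n (λ a → ∑-≤1 (λ b → nonzero≤1 (f a b)))
  where
  nonzero≤1 : ∀ x → nonzero x ≤ 1
  nonzero≤1 zero    = z≤n
  nonzero≤1 (suc x) = ≤-refl

dec : Flow n → Fin n → Fin n → Flow n
dec f u v a b = f a b ∸ unit u v a b

dec-oneMore : (f : Flow n) (u v : Fin n) → 1 ≤ f u v → OneMore f (dec f u v) u v
dec-oneMore f u v pos a b with a ≟ᶠ u | b ≟ᶠ v
... | yes refl | yes refl rewrite χ-refl a | χ-refl b = sym (m∸n+n≡m pos)
... | yes refl | no b≢v   rewrite χ-≢ b≢v | *-zeroʳ (χ a a) = sym (+-identityʳ _)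
... | no a≢u   | _        rewrite χ-≢ a≢u = sym (+-identityʳ _)

dec-≤ᶠ : (f : Flow n) (u v : Fin n) → dec f u v ≤ᶠ f
dec-≤ᶠ f u v a b = m∸n≤m (f a b) (unit u v a b)

dec-here : (f : Flow n) (u v : Fin n) → dec f u v u v ≡ pred (f u v)
dec-here f u v rewrite χ-refl u | χ-refl v = refl

dec-elsewhere : (f : Flow n) (u v a b : Fin n) → b ≢ v → dec f u v a b ≡ f a b
dec-elsewhere f u v a b b≢v rewrite χ-≢ b≢v | *-zeroʳ (χ a u) = refl

fireEdge : ∀ {P : MFDO n} {S} {c : Fin n → ℕ} {u o v} → (u , o , v) ∈ MFDO.δ P → S o →
           ∀ k (f : Flow n) (D : Config n) → f u v ≡ k → k ≤ lookup D u → Balanced (lookup D) f c →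
           ∃ λ g → ∃ λ D' → RunWithin P S D (replicate k (u , o , v)) D' ×
             Balanced (lookup D') g c × g ≤ᶠ f × g u v ≡ 0
fireEdge t∈δ o∈S zero f D f≡0 _ bal = f , D , done , bal , (λ _ _ → ≤-refl) , f≡0
fireEdge {u = u} {o} {v} t∈δ o∈S (suc k) f D f≡k k<D bal
  with fireEdge t∈δ o∈S k (dec f u v) (move D u v) (trans (dec-here f u v) (cong pred f≡k))
         k≤D' (fire {D = D} (dec-oneMore f u v f>0) D>0 bal)
  where
  f>0 : 1 ≤ f u v
  f>0 = subst (1 ≤_) (sym f≡k) (s≤s z≤n)
  D>0 : 1 ≤ lookup D u
  D>0 = ≤-trans (s≤s z≤n) k<D
  k≤D' : k ≤ lookup (move D u v) u
  k≤D' = s≤s⁻¹ (≤-trans k<D (move-source D u v D>0))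
... | g , D' , run , bal' , g≤ , g≡0 =
  g , D' , next t∈δ o∈S (≤-trans (s≤s z≤n) k<D) run , bal' ,
  (λ a b → ≤-trans (g≤ a b) (dec-≤ᶠ f u v a b)) , g≡0

-- Walk f a vs e: a path from a to e along edges with positive flow; vs
-- lists the vertices after a.
data Walk (f : Flow n) : Fin n → List (Fin n) → Fin n → Set where
  stay : ∀ {a} → Walk f a [] a
  edge : ∀ {a b vs e} → 1 ≤ f a b → Walk f b vs e → Walk f a (b ∷ vs) e

data Distinct {n : ℕ} : List (Fin n) → Set where
  []  : Distinct []
  _∷_ : ∀ {x xs} → ¬ x ∈ xs → Distinct xs → Distinct (x ∷ xs)

distinct-injective : (xs : List (Fin n)) → Distinct xs →
                     ∀ {i j} → List.lookup xs i ≡ List.lookup xs j → i ≡ j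
distinct-injective (x ∷ xs) d          {zero}  {zero}  e = refl
distinct-injective (x ∷ xs) (x∉xs ∷ d) {zero}  {suc j} e =
  ⊥-elim (x∉xs (subst (_∈ xs) (sym e) (∈-lookup j)))
distinct-injective (x ∷ xs) (x∉xs ∷ d) {suc i} {zero}  e =
  ⊥-elim (x∉xs (subst (_∈ xs) e (∈-lookup i)))
distinct-injective (x ∷ xs) (x∉xs ∷ d) {suc i} {suc j} e = cong suc (distinct-injective xs d e)

distinct-length : (xs : List (Fin n)) → Distinct xs → length xs ≤ n
distinct-length xs dxs = injective⇒≤ {f = List.lookup xs} (distinct-injective xs dxs)

walk-dec : ∀ {f : Flow n} {a vs e} p z → Walk f a vs e → ¬ z ∈ vs → Walk (dec f p z) a vs e
walk-dec p z stay z∉ = stay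
walk-dec {f = f} p z (edge {a = a} {b} pos w) z∉ =
  edge (subst (1 ≤_) (sym (dec-elsewhere f p z a b (λ b≡z → z∉ (here (sym b≡z))))) pos)
       (walk-dec p z w (z∉ ∘ there))

cancelWalk : ∀ {d c : Fin n → ℕ} (f : Flow n) {a vs e} → Walk f a vs e → Distinct vs →
             Balanced (d +[ a ]) f c → ∃ λ g → Balanced (d +[ e ]) g c × g ≤ᶠ f
cancelWalk f stay _ bal = f , bal , (λ _ _ → ≤-refl)
cancelWalk f {a} (edge {b = b} pos w) (b∉ ∷ dvs) bal
  with cancelWalk (dec f a b) (walk-dec a b w b∉) dvs (shiftToken (dec-oneMore f a b pos) bal)
... | g , bal' , g≤ = g , bal' , (λ x y → ≤-trans (g≤ x y) (dec-≤ᶠ f a b x y))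

SimpleCycle : Flow n → Set
SimpleCycle {n} f =
  ∃ λ (w : Fin n) → ∃ λ h → ∃ λ vs → Walk f w (h ∷ vs) w × Distinct (h ∷ vs)

dec-< : (f : Flow n) (u v : Fin n) → 1 ≤ f u v → dec f u v u v < f u v
dec-< f u v pos rewrite dec-here f u v with f u v | pos
... | suc k | _ = n<1+n k

cancelCycle : ∀ {d c : Fin n → ℕ} {f : Flow n} → SimpleCycle f → Balanced d f c →
              ∃ λ g → Balanced d g c × g ≤ᶠ f × total g < total f
cancelCycle {f = f} (w , h , vs , edge pos walk , h∉vs ∷ dvs) bal
  with cancelWalk (dec f w h) (walk-dec w h walk h∉vs) dvs
         (shiftToken (dec-oneMore f w h pos) (addToken w bal))
... | g , bal' , g≤ =
  g , removeToken w bal' , g≤f , total-< g≤f w h (≤-<-trans (g≤ w h) (dec-< f w h pos))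
  where
  g≤f : g ≤ᶠ f
  g≤f a b = ≤-trans (g≤ a b) (dec-≤ᶠ f w h a b)

NoReady : (Fin n → ℕ) → Flow n → Set
NoReady {n} d f = ∀ (u v : Fin n) → 1 ≤ f u v → d u < f u v

-- Without a ready edge, a vertex x with an outgoing edge also has an incoming
-- one: otherwise conservation gives outflow f x ≤ d x.
predecessor : ∀ {d c : Fin n → ℕ} {f : Flow n} → Balanced d f c → NoReady d f →
              ∀ {x y} → 1 ≤ f x y → ∃ λ w → 1 ≤ f w x
predecessor {d = d} {c} {f} bal noReady {x} {y} pos with inflow f x in eq
... | suc _ = ∑-witness (λ w → f w x) (subst (1 ≤_) (sym eq) (s≤s z≤n))
... | zero  = ⊥-elim (<⇒≱ (noReady x y pos) (begin
  f x y              ≤⟨ ∑-term (f x) y ⟩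
  outflow f x        ≤⟨ m≤n+m _ (c x) ⟩
  c x + outflow f x  ≡⟨ sym (bal x) ⟩
  d x + inflow f x   ≡⟨ cong (d x +_) eq ⟩
  d x + 0            ≡⟨ +-identityʳ (d x) ⟩
  d x                ∎))
  where open ≤-Reasoning

walkUntil : ∀ {f : Flow n} {h t e} w → Walk f h t e → Distinct (h ∷ t) → w ∈ h ∷ t →
            ∃ λ ps → Walk f h ps w × Distinct (h ∷ ps) × (∀ y → y ∈ ps → y ∈ t)
walkUntil w walk          dist       (here refl) = [] , stay , ((λ ()) ∷ []) , (λ y ())
walkUntil w stay          dist       (there ())
walkUntil w (edge {b = b} pos walk) (h∉ ∷ dist) (there w∈) with walkUntil w walk dist w∈
... | ps , walk' , (b∉ps ∷ dps) , ps⊆ =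
  b ∷ ps , edge pos walk' , (h∉ ∘ bps⊆ _) ∷ (b∉ps ∷ dps) , bps⊆
  where
  bps⊆ : ∀ y → y ∈ b ∷ ps → y ∈ _
  bps⊆ y (here y≡b)  = here y≡b
  bps⊆ y (there y∈) = there (ps⊆ y y∈)

-- Walking backwards from a vertex h with an outgoing edge, along the
-- predecessors given by `predecessor`, some vertex repeats within n steps;
-- the walk between its two visits is a simple cycle.  The budget counts the
-- steps left before the walk would exceed n distinct vertices.
findCycle : ∀ {d c : Fin n → ℕ} {f : Flow n} → Balanced d f c → NoReady d f →
            (budget : ℕ) (h : Fin n) (t : List (Fin n)) {e : Fin n} →
            Walk f h t e → Distinct (h ∷ t) →
            suc n ≤ budget + length (h ∷ t) → (∃ λ y → 1 ≤ f h y) → SimpleCycle f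
findCycle bal noReady zero h t walk dist room _ =
  ⊥-elim (<⇒≱ room (distinct-length (h ∷ t) dist))
findCycle bal noReady (suc budget) h t walk dist room (y , hy) with predecessor bal noReady hy
... | w , wh with Any.any? (w ≟ᶠ_) (h ∷ t)
...   | yes w∈ with walkUntil w walk dist w∈
...     | ps , walk' , dps , _ = w , h , ps , edge wh walk' , dps
findCycle bal noReady (suc budget) h t walk dist room (y , hy) | w , wh | no w∉ =
  findCycle bal noReady budget w (h ∷ t) (edge wh walk) (w∉ ∷ dist)
    (≤-trans room (≤-reflexive (sym (+-suc budget _)))) (h , wh)

someCycle : ∀ {d c : Fin n → ℕ} {f : Flow n} {a b} → Balanced d f c → NoReady d f →
            1 ≤ f a b → SimpleCycle f
someCycle {n} {a = a} {b} bal noReady ab =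
  findCycle bal noReady n a [] stay ((λ ()) ∷ []) (≤-reflexive (+-comm 1 n)) (b , ab)

module _ {P : MFDO n} {S : Fin n → Set} {C : Config n} where

  record Progress (D : Config n) (f : Flow n) : Set where
    field
      ρ          : List (Transition n)
      D'         : Config n
      g          : Flow n
      run        : RunWithin P S D ρ D'
      balanced   : Balanced (lookup D') g (lookup C)
      supported  : Supported P S g
      decreasing : total g < total f
      cost       : aggLen ρ + support g ≤ support f

  fireStep : ∀ {D f u v} → Balanced (lookup D) f (lookup C) → Supported P S f →
             1 ≤ f u v → f u v ≤ lookup D u → Progress D f
  fireStep {D} {f} {u} {v} bal sup pos ready with sup u v pos
  ... | o , t∈δ , o∈S with fireEdge t∈δ o∈S (f u v) f D refl ready bal
  ...   | g , D' , run , bal' , g≤f , g≡0 = record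
    { ρ          = replicate (f u v) (u , o , v)
    ; D'         = D'
    ; g          = g
    ; run        = run
    ; balanced   = bal'
    ; supported  = supported-≤ᶠ g≤f sup
    ; decreasing = total-< g≤f u v (subst (_< f u v) (sym g≡0) pos)
    ; cost       = subst (λ k → k + support g ≤ support f)
                     (sym (aggLen-replicate (f u v) (u , o , v) pos)) (support-< g≤f u v g≡0 pos)
    }

  cycleStep : ∀ {D f a b} → Balanced (lookup D) f (lookup C) → Supported P S f →
              NoReady (lookup D) f → 1 ≤ f a b → Progress D f
  cycleStep {D} bal sup noReady ab
    with cancelCycle (someCycle bal noReady ab) bal
  ... | g , bal' , g≤f , g<f = record
    { ρ = [] ; D' = D ; g = g ; run = done ; balanced = bal' ; supported = supported-≤ᶠ g≤f sup
    ; decreasing = g<f ; cost = support-mono g≤f }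

  progress : ∀ {D f a b} → Balanced (lookup D) f (lookup C) → Supported P S f →
             1 ≤ f a b → Progress D f
  progress {D} {f} bal sup ab with any? (λ u → any? (λ v → (1 ≤? f u v) ×-dec (f u v ≤? lookup D u)))
  ... | yes (u , v , pos , ready) = fireStep bal sup pos ready
  ... | no  noReadyEdge           = cycleStep bal sup noReady ab
    where
    noReady : NoReady (lookup D) f
    noReady u v pos = ≰⇒> (λ ready → noReadyEdge (u , v , pos , ready))

  realise : (D : Config n) (f : Flow n) → Acc _<_ (total f) →
            Balanced (lookup D) f (lookup C) → Supported P S f →
            ∃ λ ξ → RunWithin P S D ξ C × aggLen ξ ≤ support f
  realise D f (acc smaller) bal sup with any? (λ a → any? (λ b → 1 ≤? f a b))
  ... | no noEdge = [] , subst (RunWithin P S D []) (balanced-empty empty bal) done , z≤n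
    where
    empty : ∀ a b → f a b ≡ 0
    empty a b = n<1⇒n≡0 (≰⇒> (λ pos → noEdge (a , b , pos)))
  ... | yes (_ , _ , ab) =
    let open Progress (progress {D} bal sup ab)
        (ξ , run' , agg) = realise D' g (smaller decreasing) balanced supported
    in ρ ++ ξ , runWithin-++ run run' ,
       ≤-trans (aggLen-++ ρ ξ) (≤-trans (+-monoʳ-≤ (aggLen ρ) agg) cost)

normalise : ∀ {P : MFDO n} {S D ρ C} → RunWithin P S D ρ C →
            ∃ λ ξ → RunWithin P S D ξ C × aggLen ξ ≤ n * n
normalise {D = D} run with runFlow run
... | f , bal , sup with realise D f (<-wellFounded (total f)) bal sup
...   | ξ , run' , agg = ξ , run' , ≤-trans agg (support-bound f)

-- Seen hist C o: state o is populated somewhere in the execution C ∷ hist,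
-- so transitions observing o are enabled from now on.
Seen : List (Config n) → Config n → Fin n → Set
Seen hist C o = Any (λ D → 1 ≤ lookup D o) (C ∷ hist)

seen? : (hist : List (Config n)) (C : Config n) (o : Fin n) → Dec (Seen hist C o)
seen? hist C o = Any.any? (λ D → 1 ≤? lookup D o) (C ∷ hist)

oneIf : {A : Set} → Dec A → ℕ
oneIf (yes _) = 1
oneIf (no _)  = 0

numSeen : List (Config n) → Config n → ℕ
numSeen hist C = sum (λ x → oneIf (seen? hist C x))

numSeen-≤ : (hist : List (Config n)) (C : Config n) → numSeen hist C ≤ n
numSeen-≤ hist C = ∑-≤1 (λ x → atMostOne (seen? hist C x))
  where
  atMostOne : {A : Set} (a : Dec A) → oneIf a ≤ 1
  atMostOne (yes _) = ≤-refl
  atMostOne (no _)  = z≤n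

numSeen-pos : ∀ {hist : List (Config n)} {C} y → Seen hist C y → 1 ≤ numSeen hist C
numSeen-pos {hist = hist} {C} y seen =
  ≤-trans (one (seen? hist C y)) (∑-term (λ x → oneIf (seen? hist C x)) y)
  where
  one : (a : Dec (Seen hist C y)) → 1 ≤ oneIf a
  one (yes _)   = ≤-refl
  one (no  ¬sy) = ⊥-elim (¬sy seen)

numSeen-< : ∀ {h₁ h₂ : List (Config n)} {C₁ C₂} → (∀ x → Seen h₁ C₁ x → Seen h₂ C₂ x) →
            ∀ y → Seen h₂ C₂ y → ¬ Seen h₁ C₁ y → numSeen h₁ C₁ < numSeen h₂ C₂
numSeen-< {h₁ = h₁} {h₂} {C₁} {C₂} incl y seen unseen =
  ∑-mono-< (λ x → mono (incl x) (seen? h₁ C₁ x) (seen? h₂ C₂ x)) y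
    (strict (seen? h₁ C₁ y) (seen? h₂ C₂ y))
  where
  mono : {A B : Set} → (A → B) → (a : Dec A) (b : Dec B) → oneIf a ≤ oneIf b
  mono f (yes a) (yes _) = ≤-refl
  mono f (yes a) (no ¬b) = ⊥-elim (¬b (f a))
  mono f (no _)  _       = z≤n
  strict : (a : Dec (Seen h₁ C₁ y)) (b : Dec (Seen h₂ C₂ y)) → oneIf a < oneIf b
  strict (yes s) _       = ⊥-elim (unseen s)
  strict (no _)  (yes _) = s≤s z≤n
  strict (no _)  (no ¬s) = ⊥-elim (¬s seen)

embed : ∀ {P : MFDO n} {C₀ D histD ξ S ρ C} → Run P C₀ D histD ξ →
        (∀ o → S o → Seen histD D o) → RunWithin P S D ρ C →
        ∃ λ hist → Run P C₀ C hist (ξ ++ ρ) × (∀ o → Seen histD D o → Seen hist C o)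
embed {ξ = ξ} {C = C} run obs done =
  _ , subst (Run _ _ C _) (sym (++-identityʳ ξ)) run , (λ o seen → seen)
embed {P = P} {C₀} {ξ = ξ} run obs (next {ρ = ρ} {q} {o} {q'} t∈δ o∈S pos rest)
  with embed (step run t∈δ pos (obs o o∈S)) (λ o' s → there (obs o' s)) rest
... | hist , run' , incl =
  hist , subst (Run P C₀ _ hist) (++-assoc ξ ((q , o , q') ∷ []) ρ) run' ,
  (λ o' seen → incl o' (there seen))

-- Normalised P C₀ C hist: an execution from C₀ to C (with history hist) has
-- been rewritten as a prefix, ending at the start D of the current phase,
-- with at most n² + 1 blocks per completed phase, followed by a run within
-- the current phase, whose observers are the states seen by D.
record Normalised (P : MFDO n) (C₀ C : Config n) (hist : List (Config n)) : Set where
  field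
    D          : Config n
    histD      : List (Config n)
    prefix     : List (Transition n)
    prefixRun  : Run P C₀ D histD prefix
    prefixAgg  : aggLen prefix ≤ (n * n + 1) * (numSeen histD D ∸ 1)
    phase      : List (Transition n)
    phaseRun   : RunWithin P (Seen histD D) D phase C
    nothingNew : ∀ o → Seen hist C o → Seen histD D o

finishPhase : ∀ {P : MFDO n} {C₀ C hist} (N : Normalised P C₀ C hist) → let open Normalised N in
              ∃ λ hist' → ∃ λ ξ → Run P C₀ C hist' ξ ×
                aggLen ξ ≤ (n * n + 1) * (numSeen histD D ∸ 1) + n * n ×
                (∀ o → Seen histD D o → Seen hist' C o)
finishPhase N with normalise (Normalised.phaseRun N)
... | ξ , run , agg with embed (Normalised.prefixRun N) (λ o seen → seen) run
...   | hist' , run' , incl =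
  hist' , Normalised.prefix N ++ ξ , run' ,
  ≤-trans (aggLen-++ (Normalised.prefix N) ξ) (+-mono-≤ (Normalised.prefixAgg N) agg) , incl

continuePhase : ∀ {P : MFDO n} {C₀ C hist q o q'} (N : Normalised P C₀ C hist) → let open Normalised N in
                (q , o , q') ∈ MFDO.δ P → 1 ≤ lookup C q → Seen hist C o → Seen histD D q' →
                Normalised P C₀ (move C q q') (C ∷ hist)
continuePhase {C = C} {q = q} {o} {q'} N t∈δ pos obs q'∈ = record
  { D          = D
  ; histD      = histD
  ; prefix     = prefix
  ; prefixRun  = prefixRun
  ; prefixAgg  = prefixAgg
  ; phase      = phase ∷ʳ (q , o , q')
  ; phaseRun   = runWithin-++ phaseRun (next t∈δ (nothingNew o obs) pos done)
  ; nothingNew = nothingNew'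
  }
  where
  open Normalised N
  nothingNew' : ∀ x → Seen (C ∷ _) (move C q q') x → Seen histD D x
  nothingNew' x (here p) with move-support C q q' x pos p
  ... | inj₁ refl     = q'∈
  ... | inj₂ populated = nothingNew x (here populated)
  nothingNew' x (there seen) = nothingNew x seen

nextPhaseBound : ∀ A c c' x → x ≤ (A + 1) * (c ∸ 1) + A → 1 ≤ c → c < c' →
                 x + 1 ≤ (A + 1) * (c' ∸ 1)
nextPhaseBound A (suc c) (suc c') x agg _ (s≤s c<c') = begin
  x + 1                  ≤⟨ +-monoˡ-≤ 1 agg ⟩
  (A + 1) * c + A + 1    ≡⟨ +-assoc ((A + 1) * c) A 1 ⟩
  (A + 1) * c + (A + 1)  ≡⟨ +-comm _ (A + 1) ⟩
  (A + 1) + (A + 1) * c  ≡⟨ *-suc (A + 1) c ⟨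
  (A + 1) * suc c        ≤⟨ *-monoʳ-≤ (A + 1) c<c' ⟩
  (A + 1) * c'           ∎
  where open ≤-Reasoning

newPhase : ∀ {P : MFDO n} {C₀ C hist q o q'} (N : Normalised P C₀ C hist) → let open Normalised N in
           (q , o , q') ∈ MFDO.δ P → 1 ≤ lookup C q → Seen hist C o → ¬ Seen histD D q' →
           Normalised P C₀ (move C q q') (C ∷ hist)
newPhase {n} {C = C} {q = q} {o} {q'} N t∈δ pos obs q'∉ with finishPhase N
... | hist' , ξ , run , agg , incl = record
  { D          = move C q q'
  ; histD      = C ∷ hist'
  ; prefix     = ξ ∷ʳ (q , o , q')
  ; prefixRun  = step run t∈δ pos (incl o (nothingNew o obs))
  ; prefixAgg  = ≤-trans (aggLen-++ ξ ((q , o , q') ∷ []))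
                   (nextPhaseBound (n * n) _ _ _ agg (numSeen-pos q (nothingNew q (here pos)))
                     (numSeen-< (λ x seen → there (incl x seen))
                                q' (here (move-target C q q')) q'∉))
  ; phase      = []
  ; phaseRun   = done
  ; nothingNew = λ { x (here p) → here p ; x (there seen) → there (incl x (nothingNew x seen)) }
  }
  where open Normalised N

normalised : ∀ {P : MFDO n} {C₀ C hist ξ} → Run P C₀ C hist ξ → Normalised P C₀ C hist
normalised {C₀ = C₀} start = record
  { D = C₀ ; histD = [] ; prefix = [] ; prefixRun = start ; prefixAgg = z≤n
  ; phase = [] ; phaseRun = done ; nothingNew = λ o seen → seen }
normalised (step {q' = q'} run t∈δ pos obs) with normalised run
... | N with seen? (Normalised.histD N) (Normalised.D N) q'
...   | yes q'∈ = continuePhase N t∈δ pos obs q'∈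
...   | no  q'∉ = newPhase N t∈δ pos obs q'∉

finalBound : ∀ n c → c ≤ n → (n * n + 1) * (c ∸ 1) + n * n ≤ n ^ 4
finalBound zero    zero c≤n = z≤n
finalBound (suc m) c    c≤n = begin
  (A + 1) * (c ∸ 1) + A
    ≤⟨ +-monoˡ-≤ A (*-monoʳ-≤ (A + 1) (∸-monoˡ-≤ 1 c≤n)) ⟩
  (A + 1) * m + A
    ≤⟨ m≤m+n _ _ ⟩
  (A + 1) * m + A + m * (m * m * m + 3 * m * m + 3 * m)
    ≡⟨ expand m ⟨
  suc m ^ 4
    ∎
  where
  open ≤-Reasoning
  A : ℕ
  A = suc m * suc m
  expand : ∀ m → (1 + m) * ((1 + m) * ((1 + m) * ((1 + m) * 1))) ≡
                 ((1 + m) * (1 + m) + 1) * m + (1 + m) * (1 + m) + m * (m * m * m + 3 * m * m + 3 * m)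
  expand = solve-∀

theorem6 : ∀ {n : ℕ} (P : MFDO n) (C C' : Config n) →
    Reach P C C' →
    ∃ λ ξ → ReachVia P C ξ C' × aggLen ξ ≤ n ^ 4
theorem6 {n} P C C' (hist , ξ , run) with finishPhase (normalised run)
... | hist' , ξ' , run' , agg , _ =
  ξ' , (hist' , run') , ≤-trans agg (finalBound n _ (numSeen-≤ _ _))
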